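{- Let $A$ be a commutative ring with $1$, let $M \in \operatorname{Sym}_n(A)$, $a \in A$, $v \in A^n$ and $b \in \Sigma(a)$. If $av \in \Sigma(M)$, then $b^2 v \in \Sigma(M)$.
   Context: $\operatorname{Sym}_n(A)$ is the set of symmetric $n\times n$ matrices over $A$. $\Sigma A^2$ denotes the set of finite sums of squares of elements of $A$. A matrix $N\in\operatorname{Sym}_n(A)$ is called a sum of squares if $N=Q^tQ$ for some $Q\in\operatorname{Mat}_{m,n}(A)$ and some $m$. For $M\in\operatorname{Sym}_n(A)$, $\Sigma(M)$ is the set of all $v\in A^n$ (viewed as row vectors, so that $v^tv$ is the $n\times n$ matrix $(v_iv_j)_{i,j}$) such that $sM = v^tv + N$ for some $s\in\Sigma A^2$ and some $N\in\operatorname{Sym}_n(A)$ that is a sum of squares. For $a\in A$ regarded as a $1\times 1$ matrix, $\Sigma(a)$ is thus the set of $b\in A$ with $sa=b^2+r$ for some $s,r\in\Sigma A^2$. -}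

module Defs where

open import Level using (_⊔_)
open import Data.Nat using (ℕ; zero; suc)
open import Data.Fin using (Fin; zero; suc)

open import Data.Product using (Σ; ∃; _×_; _,_)
open import Algebra.Bundles using (CommutativeRing)

module _ {c ℓ} (A : CommutativeRing c ℓ) where
  open CommutativeRing A using (Carrier; _≈_; _+_; _*_; 0#)

  ∑ : (m : ℕ) → (Fin m → Carrier) → Carrier
  ∑ zero    f = 0#
  ∑ (suc m) f = f zero + ∑ m (λ k → f (suc k))

  Mat : ℕ → ℕ → Set c
  Mat m n = Fin m → Fin n → Carrier

  Vec : ℕ → Set c
  Vec n = Fin n → Carrier

  IsSymmetric : {n : ℕ} → Mat n n → Set ℓ
  IsSymmetric M = ∀ i j → M i j ≈ M j i

  IsSumOfSquares : Carrier → Set (c ⊔ ℓ)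
  IsSumOfSquares s = Σ ℕ λ m → Σ (Fin m → Carrier) λ x → s ≈ ∑ m (λ k → x k * x k)

  transpose-mul : {m n : ℕ} → Mat m n → Mat n n
  transpose-mul {m} Q i j = ∑ m (λ k → Q k i * Q k j)

  IsSOSMatrix : {n : ℕ} → Mat n n → Set (c ⊔ ℓ)
  IsSOSMatrix {n} N = Σ ℕ λ m → Σ (Mat m n) λ Q → ∀ i j → N i j ≈ transpose-mul Q i j

  InΣ : {n : ℕ} → Mat n n → Vec n → Set (c ⊔ ℓ)
  InΣ {n} M v =
    Σ Carrier λ s → Σ (Mat n n) λ N →
      IsSumOfSquares s × IsSymmetric N × IsSOSMatrix N ×
      (∀ i j → s * M i j ≈ v i * v j + N i j)

  _·_ : {n : ℕ} → Carrier → Vec n → Vec n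
  (a · v) i = a * v i

  InΣ₁ : Carrier → Carrier → Set (c ⊔ ℓ)
  InΣ₁ a b = InΣ {1} (λ _ _ → a) (λ _ → b)

{-# OPTIONS --safe #-}
-- Write s₁ a = b² + r with s₁, r ∈ ΣA², and t M = a² vᵗv + N with t ∈ ΣA², N a sum of
-- squares. Multiplying the second equation by s₁² gives
--   s₁² t M = (b² + r)² vᵗv + s₁² N = (b² v)ᵗ(b² v) + (2b² + r) r vᵗv + s₁² N,
-- and both (2b² + r) r vᵗv and s₁² N are sums of squares of matrices.
module Submission where

open import Defs
open import Data.Nat using (ℕ; zero; suc)
open import Data.Fin using (Fin; zero; suc)
open import Data.List using (List; []; _∷_; _++_; map; length; concatMap; lookup; tabulate)
open import Data.Product using (Σ; _,_)
open import Algebra.Bundles using (CommutativeRing)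
import Algebra.Solver.Ring.NaturalCoefficients.Default as RingSolver
import Relation.Binary.Reasoning.Setoid as SetoidReasoning

module _ {c ℓ} (A : CommutativeRing c ℓ) where
  open CommutativeRing A hiding (zero)
  open RingSolver commutativeSemiring
  open SetoidReasoning setoid

  -- Sums of squares are handled as lists of their terms, where concatenation and pairwise
  -- products are available; the Fin-indexed forms of Defs are converted back and forth.
  sumSq : List Carrier → Carrier
  sumSq []       = 0#
  sumSq (x ∷ xs) = x * x + sumSq xs

  ∑-squares≈sumSq-tabulate : ∀ m (x : Fin m → Carrier) →
                             ∑ A m (λ k → x k * x k) ≈ sumSq (tabulate x)
  ∑-squares≈sumSq-tabulate zero    x = refl
  ∑-squares≈sumSq-tabulate (suc m) x = +-cong refl (∑-squares≈sumSq-tabulate m (λ k → x (suc k)))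

  sumSq≈∑-squares-lookup : ∀ xs → sumSq xs ≈ ∑ A (length xs) (λ k → lookup xs k * lookup xs k)
  sumSq≈∑-squares-lookup []       = refl
  sumSq≈∑-squares-lookup (x ∷ xs) = +-cong refl (sumSq≈∑-squares-lookup xs)

  IsSumOfSquares⇒sumSq : ∀ {s} → IsSumOfSquares A s → Σ (List Carrier) λ xs → s ≈ sumSq xs
  IsSumOfSquares⇒sumSq (m , x , s≈∑) = tabulate x , trans s≈∑ (∑-squares≈sumSq-tabulate m x)

  sumSq⇒IsSumOfSquares : ∀ {s} xs → s ≈ sumSq xs → IsSumOfSquares A s
  sumSq⇒IsSumOfSquares xs s≈ = length xs , lookup xs , trans s≈ (sumSq≈∑-squares-lookup xs)

  sumSq-++ : ∀ xs ys → sumSq (xs ++ ys) ≈ sumSq xs + sumSq ys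
  sumSq-++ []       ys = sym (+-identityˡ _)
  sumSq-++ (x ∷ xs) ys = trans (+-cong refl (sumSq-++ xs ys)) (sym (+-assoc _ _ _))

  sumSq-map-*ˡ : ∀ x ys → sumSq (map (x *_) ys) ≈ (x * x) * sumSq ys
  sumSq-map-*ˡ x []       = sym (zeroʳ _)
  sumSq-map-*ˡ x (y ∷ ys) = begin
    (x * y) * (x * y) + sumSq (map (x *_) ys) ≈⟨ +-cong square-* (sumSq-map-*ˡ x ys) ⟩
    (x * x) * (y * y) + (x * x) * sumSq ys     ≈⟨ distribˡ _ _ _ ⟨
    (x * x) * (y * y + sumSq ys)               ∎
    where
    square-* : (x * y) * (x * y) ≈ (x * x) * (y * y)
    square-* = solve 2 (λ x y → (x :* y) :* (x :* y) := (x :* x) :* (y :* y)) refl x y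

  products : List Carrier → List Carrier → List Carrier
  products xs ys = concatMap (λ x → map (x *_) ys) xs

  sumSq-products : ∀ xs ys → sumSq (products xs ys) ≈ sumSq xs * sumSq ys
  sumSq-products []       ys = sym (zeroˡ _)
  sumSq-products (x ∷ xs) ys = begin
    sumSq (map (x *_) ys ++ products xs ys)       ≈⟨ sumSq-++ (map (x *_) ys) (products xs ys) ⟩
    sumSq (map (x *_) ys) + sumSq (products xs ys) ≈⟨ +-cong (sumSq-map-*ˡ x ys) (sumSq-products xs ys) ⟩
    (x * x) * sumSq ys + sumSq xs * sumSq ys       ≈⟨ distribʳ _ _ _ ⟨
    (x * x + sumSq xs) * sumSq ys                  ∎

  IsSumOfSquares-square : ∀ x → IsSumOfSquares A (x * x)
  IsSumOfSquares-square x = 1 , (λ _ → x) , sym (+-identityʳ _)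

  IsSumOfSquares-+ : ∀ {s t} → IsSumOfSquares A s → IsSumOfSquares A t → IsSumOfSquares A (s + t)
  IsSumOfSquares-+ S T with IsSumOfSquares⇒sumSq S | IsSumOfSquares⇒sumSq T
  ... | xs , s≈ | ys , t≈ = sumSq⇒IsSumOfSquares (xs ++ ys) (trans (+-cong s≈ t≈) (sym (sumSq-++ xs ys)))

  IsSumOfSquares-* : ∀ {s t} → IsSumOfSquares A s → IsSumOfSquares A t → IsSumOfSquares A (s * t)
  IsSumOfSquares-* S T with IsSumOfSquares⇒sumSq S | IsSumOfSquares⇒sumSq T
  ... | xs , s≈ | ys , t≈ =
    sumSq⇒IsSumOfSquares (products xs ys) (trans (*-cong s≈ t≈) (sym (sumSq-products xs ys)))

  module _ {n : ℕ} where

    gram : List (Vec A n) → Mat A n n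
    gram []       i j = 0#
    gram (q ∷ qs) i j = q i * q j + gram qs i j

    transpose-mul≈gram-tabulate : ∀ m (Q : Mat A m n) i j → transpose-mul A Q i j ≈ gram (tabulate Q) i j
    transpose-mul≈gram-tabulate zero    Q i j = refl
    transpose-mul≈gram-tabulate (suc m) Q i j =
      +-cong refl (transpose-mul≈gram-tabulate m (λ k → Q (suc k)) i j)

    gram≈transpose-mul-lookup : ∀ qs i j → gram qs i j ≈ transpose-mul A (lookup qs) i j
    gram≈transpose-mul-lookup []       i j = refl
    gram≈transpose-mul-lookup (q ∷ qs) i j = +-cong refl (gram≈transpose-mul-lookup qs i j)

    IsSOSMatrix⇒gram : ∀ {N : Mat A n n} → IsSOSMatrix A N → Σ (List (Vec A n)) λ qs → ∀ i j → N i j ≈ gram qs i j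
    IsSOSMatrix⇒gram (m , Q , N≈) = tabulate Q , λ i j → trans (N≈ i j) (transpose-mul≈gram-tabulate m Q i j)

    gram⇒IsSOSMatrix : ∀ {N : Mat A n n} qs → (∀ i j → N i j ≈ gram qs i j) → IsSOSMatrix A N
    gram⇒IsSOSMatrix qs N≈ = length qs , lookup qs , λ i j → trans (N≈ i j) (gram≈transpose-mul-lookup qs i j)

    gram-++ : ∀ qs rs i j → gram (qs ++ rs) i j ≈ gram qs i j + gram rs i j
    gram-++ []       rs i j = sym (+-identityˡ _)
    gram-++ (q ∷ qs) rs i j = trans (+-cong refl (gram-++ qs rs i j)) (sym (+-assoc _ _ _))

    gram-map-· : ∀ x qs i j → gram (map (_·_ A x) qs) i j ≈ (x * x) * gram qs i j
    gram-map-· x []       i j = sym (zeroʳ _)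
    gram-map-· x (q ∷ qs) i j = begin
      (x * q i) * (x * q j) + gram (map (_·_ A x) qs) i j ≈⟨ +-cong square-* (gram-map-· x qs i j) ⟩
      (x * x) * (q i * q j) + (x * x) * gram qs i j        ≈⟨ distribˡ _ _ _ ⟨
      (x * x) * (q i * q j + gram qs i j)                  ∎
      where
      square-* : (x * q i) * (x * q j) ≈ (x * x) * (q i * q j)
      square-* = solve 3 (λ x y z → (x :* y) :* (x :* z) := (x :* x) :* (y :* z)) refl x (q i) (q j)

    scaledRows : List Carrier → List (Vec A n) → List (Vec A n)
    scaledRows xs qs = concatMap (λ x → map (_·_ A x) qs) xs

    gram-scaledRows : ∀ xs qs i j → gram (scaledRows xs qs) i j ≈ sumSq xs * gram qs i j
    gram-scaledRows []       qs i j = sym (zeroˡ _)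
    gram-scaledRows (x ∷ xs) qs i j = begin
      gram (map (_·_ A x) qs ++ scaledRows xs qs) i j
        ≈⟨ gram-++ (map (_·_ A x) qs) (scaledRows xs qs) i j ⟩
      gram (map (_·_ A x) qs) i j + gram (scaledRows xs qs) i j
        ≈⟨ +-cong (gram-map-· x qs i j) (gram-scaledRows xs qs i j) ⟩
      (x * x) * gram qs i j + sumSq xs * gram qs i j
        ≈⟨ distribʳ _ _ _ ⟨
      (x * x + sumSq xs) * gram qs i j
        ∎

    IsSOSMatrix-outer : ∀ (v : Vec A n) → IsSOSMatrix A (λ i j → v i * v j)
    IsSOSMatrix-outer v = 1 , (λ _ → v) , λ i j → sym (+-identityʳ _)

    IsSOSMatrix-+ : ∀ {N N′ : Mat A n n} → IsSOSMatrix A N → IsSOSMatrix A N′ → IsSOSMatrix A (λ i j → N i j + N′ i j)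
    IsSOSMatrix-+ P P′ with IsSOSMatrix⇒gram P | IsSOSMatrix⇒gram P′
    ... | qs , N≈ | rs , N′≈ =
      gram⇒IsSOSMatrix (qs ++ rs) λ i j → trans (+-cong (N≈ i j) (N′≈ i j)) (sym (gram-++ qs rs i j))

    IsSOSMatrix-*ˡ : ∀ {s} {N : Mat A n n} → IsSumOfSquares A s → IsSOSMatrix A N → IsSOSMatrix A (λ i j → s * N i j)
    IsSOSMatrix-*ˡ S P with IsSumOfSquares⇒sumSq S | IsSOSMatrix⇒gram P
    ... | xs , s≈ | qs , N≈ =
      gram⇒IsSOSMatrix (scaledRows xs qs) λ i j →
        trans (*-cong s≈ (N≈ i j)) (sym (gram-scaledRows xs qs i j))

    transpose-mul-symmetric : ∀ {m} (Q : Mat A m n) → IsSymmetric A (transpose-mul A Q)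
    transpose-mul-symmetric {zero}  Q i j = refl
    transpose-mul-symmetric {suc m} Q i j =
      +-cong (*-comm _ _) (transpose-mul-symmetric (λ k → Q (suc k)) i j)

    IsSOSMatrix⇒IsSymmetric : ∀ {N : Mat A n n} → IsSOSMatrix A N → IsSymmetric A N
    IsSOSMatrix⇒IsSymmetric (m , Q , N≈) i j =
      trans (N≈ i j) (trans (transpose-mul-symmetric Q i j) (sym (N≈ j i)))

    IsSOSMatrix⇒diagonal-IsSumOfSquares : ∀ {N : Mat A n n} → IsSOSMatrix A N → ∀ i → IsSumOfSquares A (N i i)
    IsSOSMatrix⇒diagonal-IsSumOfSquares (m , Q , N≈) i = m , (λ k → Q k i) , N≈ i i

  scaled-Σ-equation : ∀ {s a b r t m x y N} → s * a ≈ b * b + r → t * m ≈ (a * x) * (a * y) + N →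
                      ((s * s) * t) * m ≈ (b * b * x) * (b * b * y) + ((b * b + (b * b + r)) * r * (x * y) + (s * s) * N)
  scaled-Σ-equation {s} {a} {b} {r} {t} {m} {x} {y} {N} sa≈ tm≈ = begin
    ((s * s) * t) * m                                   ≈⟨ *-assoc _ _ _ ⟩
    (s * s) * (t * m)                                   ≈⟨ *-cong refl tm≈ ⟩
    (s * s) * ((a * x) * (a * y) + N)                   ≈⟨ regroup-s² ⟩
    ((s * a) * (s * a)) * (x * y) + (s * s) * N         ≈⟨ +-cong (*-cong (*-cong sa≈ sa≈) refl) refl ⟩
    ((b * b + r) * (b * b + r)) * (x * y) + (s * s) * N ≈⟨ +-cong expand-square refl ⟩
    ((b * b * x) * (b * b * y) + (b * b + (b * b + r)) * r * (x * y)) + (s * s) * N ≈⟨ +-assoc _ _ _ ⟩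
    (b * b * x) * (b * b * y) + ((b * b + (b * b + r)) * r * (x * y) + (s * s) * N) ∎
    where
    regroup-s² : (s * s) * ((a * x) * (a * y) + N) ≈ ((s * a) * (s * a)) * (x * y) + (s * s) * N
    regroup-s² = solve 5 (λ s a x y N → (s :* s) :* ((a :* x) :* (a :* y) :+ N)
                                      := ((s :* a) :* (s :* a)) :* (x :* y) :+ (s :* s) :* N) refl s a x y N
    expand-square : ((b * b + r) * (b * b + r)) * (x * y) ≈ (b * b * x) * (b * b * y) + (b * b + (b * b + r)) * r * (x * y)
    expand-square = solve 4 (λ b r x y → ((b :* b :+ r) :* (b :* b :+ r)) :* (x :* y)
                                       := (b :* b :* x) :* (b :* b :* y) :+ (b :* b :+ (b :* b :+ r)) :* r :* (x :* y))
                            refl b r x y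

lemma3p9 : ∀ {c ℓ} (A : CommutativeRing c ℓ) → let open CommutativeRing A in
    (n : ℕ) (M : Mat A n n) (a : Carrier) (v : Vec A n) (b : Carrier) →
    IsSymmetric A M → InΣ₁ A a b → InΣ A M (_·_ A a v) →
    InΣ A M (_·_ A (b * b) v)
lemma3p9 A n M a v b _ (s , R , S , _ , sosR , sa≈) (t , N , T , _ , sosN , tM≈) =
  (s * s) * t , N′ , IsSumOfSquares-* A (IsSumOfSquares-* A S S) T ,
  IsSOSMatrix⇒IsSymmetric A sosN′ , sosN′ ,
  λ i j → scaled-Σ-equation A (sa≈ zero zero) (tM≈ i j)
  where
  open CommutativeRing A using (Carrier; _+_; _*_)
  r : Carrier
  r = R zero zero
  sosr : IsSumOfSquares A r
  sosr = IsSOSMatrix⇒diagonal-IsSumOfSquares A sosR zero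
  sosb² : IsSumOfSquares A (b * b)
  sosb² = IsSumOfSquares-square A b
  N′ : Mat A n n
  N′ i j = (b * b + (b * b + r)) * r * (v i * v j) + (s * s) * N i j
  sosN′ : IsSOSMatrix A N′
  sosN′ = IsSOSMatrix-+ A
    (IsSOSMatrix-*ˡ A (IsSumOfSquares-* A (IsSumOfSquares-+ A sosb² (IsSumOfSquares-+ A sosb² sosr)) sosr)
                      (IsSOSMatrix-outer A v))
    (IsSOSMatrix-*ˡ A (IsSumOfSquares-* A S S) sosN)
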